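{- Let $(X, \delta\colon X \rightarrow (\mathcal{P}_{\omega} X)^A)$ be an LTS. Then for all $x \in X$, $\bar{w}\in (A \times \mathcal{P}_{\omega}({A}))^{*}$ and $\mathcal{I}\in\{\mathcal{RT},\mathcal{FT}\}$, $[\![ \{x\} ]\!](\bar{w}) = \varphi^{\mathcal{I}}_{x}(\bar{w})$.
   Context: An LTS is a pair $(X,\delta\colon X\to(\mathcal{P}_\omega X)^A)$ ($\mathcal{P}_\omega$ = finite powerset). For $\varphi\colon A\to\mathcal{P}_\omega X$, $I(\varphi)=\{a\mid\varphi(a)\neq\emptyset\}$ and $Fail(\varphi)=\{Z\subseteq A\mid Z\cap I(\varphi)=\emptyset\}$. The transition function is modified to $\overline{\delta}\colon X\to(\mathcal{P}_\omega X)^{A\times\mathcal{P}_\omega(A)}$, $\overline{\delta}(x)(\langle a,Z\rangle)=\delta(x)(a)$ if $Z=I(\delta(x))$ and $\emptyset$ otherwise; write $x\xrightarrow{\bar w}y$ for the transitions of $\overline{\delta}$, extended to words over $A\times\mathcal{P}_\omega(A)$. The states are decorated with $\overline{o}_{\mathcal{RT}}(x)=\{I(\delta(x))\}$ (ready trace) or $\overline{o}_{\mathcal{FT}}(x)=Fail(\delta(x))$ (failure trace), in $B=\mathcal{P}_\omega(\mathcal{P}_\omega A)$. The decorated system is determinised into the Moore automaton $(\mathcal{P}_\omega X,\langle o,t\rangle)$ with input alphabet $A\times\mathcal{P}_\omega(A)$, $o(Y)=\bigcup_{y\in Y}\overline{o}_{\mathcal{I}}(y)$, $t(Y)(\langle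 a,Z\rangle)=\bigcup_{y\in Y}\overline{\delta}(y)(\langle a,Z\rangle)$; $[\![-]\!]$ is the unique map into the final Moore coalgebra, $[\![Y]\!](\varepsilon)=o(Y)$, $[\![Y]\!](\langle a,Z\rangle\bar w)=[\![t(Y)(\langle a,Z\rangle)]\!](\bar w)$. Finally $\varphi^{\mathcal{RT}}_x(\bar w)=\{Z\subseteq A\mid x\xrightarrow{\bar w}y\land Z=I(\delta(y))\}$ and $\varphi^{\mathcal{FT}}_x(\bar w)=\{Z\subseteq A\mid x\xrightarrow{\bar w}y\land Z\in Fail(\delta(y))\}$, encoding the ready traces, resp. failure traces, of $x$. -}

module Defs where

open import Data.Nat using (ℕ)
open import Data.Fin using (Fin)
open import Data.Fin.Subset using (Subset; _∩_; ⊥)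
open import Data.Bool using (Bool; true; false)
import Data.Bool.Properties as BoolP
open import Data.Vec using (tabulate)
open import Data.Vec.Properties using (≡-dec)
open import Data.List using (List; []; _∷_; concatMap)
open import Data.List.Membership.Propositional using (_∈_)
open import Data.Product using (_×_; _,_; ∃; ∃-syntax)
open import Relation.Nullary using (yes; no)
open import Relation.Binary.PropositionalEquality using (_≡_)

-- Action alphabet A = Fin n (finite); P_ω(A) = Subset n (canonical, so = is ≡).
-- P_ω X is represented by List X (finite sets up to membership).

LTS : ℕ → Set → Set
LTS n X = X → Fin n → List X

_≟ₛ_ : ∀ {n} → (Z Z' : Subset n) → Relation.Nullary.Dec (Z ≡ Z')
_≟ₛ_ = ≡-dec BoolP._≟_

nonEmpty : ∀ {X : Set} → List X → Bool
nonEmpty []      = false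
nonEmpty (_ ∷ _) = true

I : ∀ {n} {X : Set} → (Fin n → List X) → Subset n
I φ = tabulate (λ a → nonEmpty (φ a))

Fail : ∀ {n} {X : Set} → (Fin n → List X) → Subset n → Set
Fail φ Z = Z ∩ I φ ≡ ⊥

Letter : ℕ → Set
Letter n = Fin n × Subset n

δ̄ : ∀ {n} {X : Set} → LTS n X → X → Letter n → List X
δ̄ δ x (a , Z) with Z ≟ₛ I (δ x)
... | yes _ = δ x a
... | no  _ = []

data _⊢_—[_]→_ {n} {X : Set} (δ : LTS n X) : X → List (Letter n) → X → Set where
  ε-step : ∀ {x} → δ ⊢ x —[ [] ]→ x
  ∷-step : ∀ {x y z c w} → y ∈ δ̄ δ x c → δ ⊢ y —[ w ]→ z → δ ⊢ x —[ c ∷ w ]→ z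

data Sem : Set where
  RT FT : Sem

-- B = P_ω(P_ω A), represented as predicates on Subset n
Out : ℕ → Set₁
Out n = Subset n → Set

ō : ∀ {n} {X : Set} → Sem → LTS n X → X → Out n
ō RT δ x Z = Z ≡ I (δ x)
ō FT δ x Z = Fail (δ x) Z

-- determinised Moore automaton on P_ω X
o : ∀ {n} {X : Set} → Sem → LTS n X → List X → Out n
o 𝓘 δ Y Z = ∃[ y ] (y ∈ Y × ō 𝓘 δ y Z)

t : ∀ {n} {X : Set} → LTS n X → List X → Letter n → List X
t δ Y c = concatMap (λ y → δ̄ δ y c) Y

-- unique map into the final Moore coalgebra (words ↦ outputs)
⟦_⟧ : ∀ {n} {X : Set} → (Sem × LTS n X) → List X → List (Letter n) → Out n
⟦ 𝓘 , δ ⟧ Y []      = o 𝓘 δ Y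
⟦ 𝓘 , δ ⟧ Y (c ∷ w) = ⟦ 𝓘 , δ ⟧ (t δ Y c) w

φ : ∀ {n} {X : Set} → Sem → LTS n X → X → List (Letter n) → Out n
φ RT δ x w Z = ∃[ y ] (δ ⊢ x —[ w ]→ y × Z ≡ I (δ y))
φ FT δ x w Z = ∃[ y ] (δ ⊢ x —[ w ]→ y × Fail (δ y) Z)

module Submission where

-- The determinised Moore automaton runs on sets of states; after reading a
-- word w̄ from a set Y it sits in exactly the set of states reachable from Y
-- along w̄ in the decorated LTS δ̄.  Its output is the union of the
-- decorations ō_𝓘 of the current states, so [[Y]](w̄) collects ō_𝓘(y) for
-- every y reachable from Y along w̄.
--
-- For Y = {x}
-- "reachable from {x}" is "reachable from x", and φ^𝓘_x(w̄) is, for both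
-- 𝓘 = RT and 𝓘 = FT, literally the union of the decorations of those
-- states; composing the three equivalences gives the theorem.

open import Defs
open import Data.Nat using (ℕ)
open import Data.Fin.Subset using (Subset)
open import Data.List using (List; [_]; []; _∷_)
open import Data.List.Relation.Unary.Any using (here)
open import Data.List.Membership.Propositional using (_∈_)
open import Data.List.Membership.Propositional.Properties using (>>=-∈↔)
open import Data.Product using (_,_; _×_; ∃-syntax)
open import Relation.Binary.PropositionalEquality using (refl)
open import Function.Bundles using (_⇔_; mk⇔; Equivalence)
open import Function.Properties.Inverse using (↔⇒⇔)
open import Function.Construct.Identity using (⇔-id)
open import Function.Construct.Symmetry using (⇔-sym)
open import Function.Related.Propositional using (module EquationalReasoning)

open Equivalence using (to; from)
open EquationalReasoning

∃×-congˡ : {Y : Set} {P Q R : Y → Set} → (∀ y → P y ⇔ Q y) →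
           (∃[ y ] (P y × R y)) ⇔ (∃[ y ] (Q y × R y))
∃×-congˡ P⇔Q = mk⇔
  (λ { (y , p , r) → y , to (P⇔Q y) p , r })
  (λ { (y , q , r) → y , from (P⇔Q y) q , r })

module _ {n : ℕ} {X : Set} (δ : LTS n X) where

  Reach : List X → List (Letter n) → X → Set
  Reach Y w y = ∃[ y₀ ] (y₀ ∈ Y × δ ⊢ y₀ —[ w ]→ y)

  ∈-t⇔ : ∀ {Y c y} → (∃[ y₀ ] (y₀ ∈ Y × y ∈ δ̄ δ y₀ c)) ⇔ y ∈ t δ Y c
  ∈-t⇔ = ↔⇒⇔ >>=-∈↔

  Reach-ε : ∀ {Y y} → Reach Y [] y ⇔ y ∈ Y
  Reach-ε = mk⇔
    (λ { (_ , y∈Y , ε-step) → y∈Y })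
    (λ y∈Y → _ , y∈Y , ε-step)

  Reach-step : ∀ {Y c w y} → Reach (t δ Y c) w y ⇔ Reach Y (c ∷ w) y
  Reach-step {Y} {c} = mk⇔
    (λ { (y₁ , y₁∈tY , y₁⟶y) →
           let y₀ , y₀∈Y , y₀⟶y₁ = from (∈-t⇔ {Y} {c}) y₁∈tY
           in y₀ , y₀∈Y , ∷-step y₀⟶y₁ y₁⟶y })
    (λ { (y₀ , y₀∈Y , ∷-step y₀⟶y₁ y₁⟶y) →
           _ , to (∈-t⇔ {Y} {c}) (y₀ , y₀∈Y , y₀⟶y₁) , y₁⟶y })

  Reach-singleton : ∀ {x w y} → Reach [ x ] w y ⇔ δ ⊢ x —[ w ]→ y
  Reach-singleton = mk⇔
    (λ { (_ , here refl , x⟶y) → x⟶y })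
    (λ x⟶y → _ , here refl , x⟶y)

  ⟦⟧⇔reached : ∀ 𝓘 Y w Z →
               ⟦ 𝓘 , δ ⟧ Y w Z ⇔ (∃[ y ] (Reach Y w y × ō 𝓘 δ y Z))
  ⟦⟧⇔reached 𝓘 Y [] Z = ∃×-congˡ (λ _ → ⇔-sym Reach-ε)
  ⟦⟧⇔reached 𝓘 Y (c ∷ w) Z = begin
    ⟦ 𝓘 , δ ⟧ (t δ Y c) w Z                        ∼⟨ ⟦⟧⇔reached 𝓘 (t δ Y c) w Z ⟩
    (∃[ y ] (Reach (t δ Y c) w y × ō 𝓘 δ y Z))     ∼⟨ ∃×-congˡ (λ _ → Reach-step) ⟩
    (∃[ y ] (Reach Y (c ∷ w) y × ō 𝓘 δ y Z))       ∎

  φ⇔reached : ∀ 𝓘 x w Z →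
              φ 𝓘 δ x w Z ⇔ (∃[ y ] (δ ⊢ x —[ w ]→ y × ō 𝓘 δ y Z))
  φ⇔reached RT x w Z = ⇔-id _
  φ⇔reached FT x w Z = ⇔-id _

theorem4p4 : (n : ℕ) (X : Set) (δ : LTS n X) (x : X) (w : List (Letter n)) (𝓘 : Sem) →
    (Z : Subset n) → ⟦ 𝓘 , δ ⟧ [ x ] w Z ⇔ φ 𝓘 δ x w Z
theorem4p4 _ _ δ x w 𝓘 Z = begin
  ⟦ 𝓘 , δ ⟧ [ x ] w Z                            ∼⟨ ⟦⟧⇔reached δ 𝓘 [ x ] w Z ⟩
  (∃[ y ] (Reach δ [ x ] w y × ō 𝓘 δ y Z))       ∼⟨ ∃×-congˡ (λ _ → Reach-singleton δ) ⟩
  (∃[ y ] (δ ⊢ x —[ w ]→ y × ō 𝓘 δ y Z))         ∼⟨ ⇔-sym (φ⇔reached δ 𝓘 x w Z) ⟩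
  φ 𝓘 δ x w Z                                    ∎
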